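{- Let $F:\mathbf{Set}\to\mathbf{Set}$ be a covariant functor and $\phi:G_1\to G_2$ a homomorphism of $F$-graphs, $G_1=(E_1,V_1,g_1)$. Then $\phi$ is a monomorphism in $\mathbf{Gr}_F$ if and only if the largest graph relation $(R_E,R_V)$ between $G_1$ and $G_1$ with $R_E\subseteq\ker\phi_E$ and $R_V\subseteq\ker\phi_V$ is the diagonal $(\Delta_{E_1},\Delta_{V_1})$.
   Context: An $F$-graph is a triple $(E,V,g)$ with sets $E$, $V$ and a map $g:E\to FV$. A homomorphism $\phi:(E_1,V_1,g_1)\to(E_2,V_2,g_2)$ is a pair of maps with $g_2\circ\phi_E=F(\phi_V)\circ g_1$; these form the category $\mathbf{Gr}_F$. $\ker f=\{(a,b):f(a)=f(b)\}$. A graph relation between $F$-graphs $H_1=(E_1,V_1,g_1)$ and $H_2=(E_2,V_2,g_2)$ is a pair $R=(R_E,R_V)$, $R_E\subseteq E_1\times E_2$, $R_V\subseteq V_1\times V_2$, for which there is a map $g_R:R_E\to FR_V$ making both pairs of canonical projections $(R_E,R_V,g_R)\to H_1$, $(R_E,R_V,g_R)\to H_2$ homomorphisms. For any pair of relations $(S_E,S_V)$, $S_E\subseteq E_1\times E_2$, $S_V\subseteq V_1\times V_2$, there exists a largest graph relation $(R_E,R_V)$ with $R_E\subseteq S_E$ and $R_V\subseteq S_V$ (componentwise inclusion). -}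

module Defs where

open import Level using (suc; zero)
open import Data.Product using (Σ; Σ-syntax; _×_; _,_; proj₁; proj₂)
open import Relation.Binary.PropositionalEquality using (_≡_)
open import Function using (_∘_; id)

-- A covariant functor Set → Set (object map, morphism map, functor laws
-- stated pointwise, since Agda has no function extensionality).
record Functor : Set₁ where
  field
    F₀   : Set → Set
    fmap : {A B : Set} → (A → B) → F₀ A → F₀ B
    fmap-id : {A : Set} (x : F₀ A) → fmap id x ≡ x
    fmap-∘  : {A B C : Set} (g : B → C) (f : A → B) (x : F₀ A) →
              fmap (g ∘ f) x ≡ fmap g (fmap f x)
open Functor public

module _ (F : Functor) where

  record Graph : Set₁ where
    constructor mkGraph
    field
      E : Set
      V : Set
      g : E → F₀ F V
  open Graph public

  record Hom (G₁ G₂ : Graph) : Set where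
    constructor mkHom
    field
      homE : E G₁ → E G₂
      homV : V G₁ → V G₂
      comm : (e : E G₁) → g G₂ (homE e) ≡ fmap F homV (g G₁ e)
  open Hom public

  _≈Hom_ : {G₁ G₂ : Graph} → Hom G₁ G₂ → Hom G₁ G₂ → Set
  α ≈Hom β = ((e : _) → homE α e ≡ homE β e) × ((v : _) → homV α v ≡ homV β v)

  Mono : {G₁ G₂ : Graph} → Hom G₁ G₂ → Set₁
  Mono {G₁} {G₂} φ =
    (H : Graph) (α β : Hom H G₁) →
    ((e : E H) → homE φ (homE α e) ≡ homE φ (homE β e)) →
    ((v : V H) → homV φ (homV α v) ≡ homV φ (homV β v)) →
    α ≈Hom β

  Rel₂ : Set → Set → Set₁
  Rel₂ A B = A → B → Set

  _⊆_ : {A B : Set} → Rel₂ A B → Rel₂ A B → Set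
  R ⊆ S = ∀ {a b} → R a b → S a b

  Pairs : {A B : Set} → Rel₂ A B → Set
  Pairs {A} {B} R = Σ[ a ∈ A ] Σ[ b ∈ B ] R a b

  π₁ : {A B : Set} {R : Rel₂ A B} → Pairs R → A
  π₁ (a , _ , _) = a

  π₂ : {A B : Set} {R : Rel₂ A B} → Pairs R → B
  π₂ (_ , b , _) = b

  record PairRel (H₁ H₂ : Graph) : Set₁ where
    constructor _,ᴿ_
    field
      RE : Rel₂ (E H₁) (E H₂)
      RV : Rel₂ (V H₁) (V H₂)
  open PairRel public

  _⊆ᴿ_ : {H₁ H₂ : Graph} → PairRel H₁ H₂ → PairRel H₁ H₂ → Set
  R ⊆ᴿ S = (RE R ⊆ RE S) × (RV R ⊆ RV S)

  -- Graph relation: there is g_R : R_E → F R_V making both projections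
  -- (R_E, R_V, g_R) → H₁ and → H₂ homomorphisms.
  IsGraphRelation : {H₁ H₂ : Graph} → PairRel H₁ H₂ → Set
  IsGraphRelation {H₁} {H₂} R =
    Σ[ gR ∈ (Pairs (RE R) → F₀ F (Pairs (RV R))) ]
      (((r : Pairs (RE R)) → g H₁ (π₁ r) ≡ fmap F π₁ (gR r)) ×
       ((r : Pairs (RE R)) → g H₂ (π₂ r) ≡ fmap F π₂ (gR r)))

  IsLargestGraphRelationIn : {H₁ H₂ : Graph} → PairRel H₁ H₂ → PairRel H₁ H₂ → Set₁
  IsLargestGraphRelationIn {H₁} {H₂} S R =
    IsGraphRelation R × (R ⊆ᴿ S) ×
    ((R' : PairRel H₁ H₂) → IsGraphRelation R' → R' ⊆ᴿ S → R' ⊆ᴿ R)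

  kerᴴ : {G₁ G₂ : Graph} → Hom G₁ G₂ → PairRel G₁ G₁
  kerᴴ φ = (λ a b → homE φ a ≡ homE φ b) ,ᴿ (λ a b → homV φ a ≡ homV φ b)

  Δᴴ : (G : Graph) → PairRel G G
  Δᴴ G = _≡_ ,ᴿ _≡_

  _≐ᴿ_ : {H₁ H₂ : Graph} → PairRel H₁ H₂ → PairRel H₁ H₂ → Set
  R ≐ᴿ S = (R ⊆ᴿ S) × (S ⊆ᴿ R)

-- For α, β : H → G₁ with φ ∘ α = φ ∘ β, the joint image {(α x, β x)} is a
-- graph relation inside ker φ, hence inside R; so R ⊆ Δ forces α = β, and
-- α = β = id shows Δ ⊆ R. Conversely R is the joint image of the two
-- projections of its own span graph, which φ equalises, so if φ is mono
-- those projections agree and R ⊆ Δ.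
module Submission where

open import Data.Product using (Σ-syntax; _×_; _,_; proj₁; proj₂)
open import Function using (id)
open import Function.Bundles using (_⇔_; mk⇔)
open import Relation.Binary.PropositionalEquality using (_≡_; refl; sym; trans; cong)

open import Defs

module _ (F : Functor) where

  idHom : (G : Graph F) → Hom F G G
  idHom G = mkHom id id (λ e → sym (fmap-id F (g G e)))

  EqualisedBy : {H G₁ G₂ : Graph F} → Hom F G₁ G₂ → (α β : Hom F H G₁) → Set
  EqualisedBy φ α β =
    ((e : _) → homE φ (homE α e) ≡ homE φ (homE β e)) ×
    ((v : _) → homV φ (homV α v) ≡ homV φ (homV β v))

  module _ {H₁ H₂ : Graph F} (R : PairRel F H₁ H₂) (isGR : IsGraphRelation F R) where

    spanGraph : Graph F
    spanGraph = mkGraph (Pairs F (RE R)) (Pairs F (RV R)) (proj₁ isGR)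

    spanFst : Hom F spanGraph H₁
    spanFst = mkHom (π₁ F) (π₁ F) (proj₁ (proj₂ isGR))

    spanSnd : Hom F spanGraph H₂
    spanSnd = mkHom (π₂ F) (π₂ F) (proj₂ (proj₂ isGR))

  module _ {H G₁ G₂ : Graph F} (α : Hom F H G₁) (β : Hom F H G₂) where

    jointImage : PairRel F G₁ G₂
    jointImage = (λ a b → Σ[ e ∈ E H ] (homE α e ≡ a × homE β e ≡ b))
              ,ᴿ (λ a b → Σ[ v ∈ V H ] (homV α v ≡ a × homV β v ≡ b))

    jointImage-isGraphRelation : IsGraphRelation F jointImage
    jointImage-isGraphRelation = gR , gR-fst , gR-snd
      where
      pair : V H → Pairs F (RV jointImage)
      pair v = homV α v , homV β v , v , refl , refl

      gR : Pairs F (RE jointImage) → F₀ F (Pairs F (RV jointImage))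
      gR (_ , _ , e , _ , _) = fmap F pair (g H e)

      gR-fst : (r : Pairs F (RE jointImage)) → g G₁ (π₁ F r) ≡ fmap F (π₁ F) (gR r)
      gR-fst (_ , _ , e , refl , refl) = trans (comm α e) (fmap-∘ F (π₁ F) pair (g H e))

      gR-snd : (r : Pairs F (RE jointImage)) → g G₂ (π₂ F r) ≡ fmap F (π₂ F) (gR r)
      gR-snd (_ , _ , e , refl , refl) = trans (comm β e) (fmap-∘ F (π₂ F) pair (g H e))

  jointImage⊆kerᴴ : {H G₁ G₂ : Graph F} (φ : Hom F G₁ G₂) (α β : Hom F H G₁) →
    EqualisedBy φ α β → _⊆ᴿ_ F (jointImage α β) (kerᴴ F φ)
  jointImage⊆kerᴴ φ α β (eqE , eqV) =
    (λ { (e , refl , refl) → eqE e }) , (λ { (v , refl , refl) → eqV v })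

  module _ {G₁ G₂ : Graph F} (φ : Hom F G₁ G₂) (R : PairRel F G₁ G₁)
           (largest : IsLargestGraphRelationIn F (kerᴴ F φ) R) where

    largest-relates-equalised : {H : Graph F} (α β : Hom F H G₁) → EqualisedBy φ α β →
      ((e : E H) → RE R (homE α e) (homE β e)) × ((v : V H) → RV R (homV α v) (homV β v))
    largest-relates-equalised α β equalised =
      (λ e → proj₁ image⊆R (e , refl , refl)) , (λ v → proj₂ image⊆R (v , refl , refl))
      where
      image⊆R : _⊆ᴿ_ F (jointImage α β) R
      image⊆R = proj₂ (proj₂ largest) (jointImage α β)
        (jointImage-isGraphRelation α β) (jointImage⊆kerᴴ φ α β equalised)

    Δᴴ⊆largest : _⊆ᴿ_ F (Δᴴ F G₁) R
    Δᴴ⊆largest = (λ { refl → proj₁ relates _ }) , (λ { refl → proj₂ relates _ })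
      where
      relates : ((e : E G₁) → RE R e e) × ((v : V G₁) → RV R v v)
      relates = largest-relates-equalised (idHom G₁) (idHom G₁) ((λ _ → refl) , (λ _ → refl))

    largest⊆Δᴴ⇒mono : _⊆ᴿ_ F R (Δᴴ F G₁) → Mono F φ
    largest⊆Δᴴ⇒mono (RE⊆≡ , RV⊆≡) H α β eqE eqV =
      (λ e → RE⊆≡ (proj₁ relates e)) , (λ v → RV⊆≡ (proj₂ relates v))
      where
      relates : ((e : E H) → RE R (homE α e) (homE β e)) ×
                ((v : V H) → RV R (homV α v) (homV β v))
      relates = largest-relates-equalised α β (eqE , eqV)

    mono⇒largest⊆Δᴴ : Mono F φ → _⊆ᴿ_ F R (Δᴴ F G₁)
    mono⇒largest⊆Δᴴ mono =
      (λ {a} {b} r → proj₁ fst≈snd (a , b , r)) , (λ {a} {b} r → proj₂ fst≈snd (a , b , r))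
      where
      isGR : IsGraphRelation F R
      isGR = proj₁ largest
      R⊆ker : _⊆ᴿ_ F R (kerᴴ F φ)
      R⊆ker = proj₁ (proj₂ largest)
      fst≈snd : _≈Hom_ F (spanFst R isGR) (spanSnd R isGR)
      fst≈snd = mono (spanGraph R isGR) (spanFst R isGR) (spanSnd R isGR)
        (λ { (_ , _ , r) → proj₁ R⊆ker r }) (λ { (_ , _ , r) → proj₂ R⊆ker r })

theorem6p5 : (F : Functor) (G₁ G₂ : Graph F) (φ : Hom F G₁ G₂)
    (R : PairRel F G₁ G₁) →
    IsLargestGraphRelationIn F (kerᴴ F φ) R →
    (Mono F φ ⇔ _≐ᴿ_ F R (Δᴴ F G₁))
theorem6p5 F G₁ G₂ φ R largest = mk⇔
  (λ mono → mono⇒largest⊆Δᴴ F φ R largest mono , Δᴴ⊆largest F φ R largest)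
  (λ { (R⊆Δ , _) → largest⊆Δᴴ⇒mono F φ R largest R⊆Δ })
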